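{- Let $G$ be the edge-colored multigraph corresponding to an open shop system with unit machine capacities. The following are equivalent: (i) $G$ contains a simple cycle whose edges have pairwise distinct colors; (ii) $G$ contains a 2-vertex-connected component that spans edges of at least two different colors; (iii) $G$ contains a simple cycle whose edges have at least two different colors.
   Context: An open shop system consists of jobs $J_1,\ldots,J_n$ and machines $M_1,\ldots,M_m$; each job $J_j$ has a set $\mathcal{M}(J_j)\subseteq\{M_1,\ldots,M_m\}$ of machines on which it must be processed; here every machine has capacity $1$. The corresponding edge-colored multigraph $G$ has vertex set $\{M_1,\ldots,M_m\}$; for each job $J_j$ it contains an edge of color $c_j$ between every pair of distinct machines in $\mathcal{M}(J_j)$ (a clique on $\mathcal{M}(J_j)$ in color $c_j$), where the colors $c_1,\ldots,c_n$ are pairwise distinct. -}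

module Defs where


open import Data.Nat using (ℕ; _≤_) renaming (suc to 1+)
open import Data.Fin using (Fin; zero; suc; _<_; fromℕ; inject₁)
open import Data.Fin.Subset using (Subset; _∈_)
open import Data.Product using (Σ; ∃; ∃-syntax; _×_; _,_)
open import Data.Sum using (_⊎_)
open import Relation.Binary.PropositionalEquality using (_≡_; _≢_)
open import Relation.Nullary using (¬_)
open import Data.Unit using (⊤)

-- An open shop system with n jobs and m machines (unit capacities):
-- job j must be processed on the machine set  Shop j ⊆ {M_1..M_m}.
OpenShop : ℕ → ℕ → Set
OpenShop n m = Fin n → Subset m

SamePair : ∀ {m} → Fin m → Fin m → Fin m → Fin m → Set
SamePair a b c d = (a ≡ c × b ≡ d) ⊎ (a ≡ d × b ≡ c)

module _ {n m : ℕ} (S : OpenShop n m) where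

  -- An edge of the multigraph G: the edge of color (job) col between the
  -- distinct machines u,v of that job.  The unordered pair is stored with u < v,
  -- so each edge of G is represented exactly once.
  record Edge : Set where
    constructor edge
    field
      col : Fin n
      u v : Fin m
      u<v : u < v
      u∈  : u ∈ S col
      v∈  : v ∈ S col
  open Edge public

  Joins : Edge → Fin m → Fin m → Set
  Joins e x y = SamePair (u e) (v e) x y

  -- A (edge-)subgraph of G, given by its edge set; its vertex set is the set of
  -- endpoints of its edges.
  Subgraph : Set₁
  Subgraph = Edge → Set

  _⊆ᴱ_ : Subgraph → Subgraph → Set
  H ⊆ᴱ K = ∀ e → H e → K e

  InV : Subgraph → Fin m → Set
  InV H x = ∃[ e ] (H e × (u e ≡ x ⊎ v e ≡ x))

  data Reach (H : Subgraph) (ok : Fin m → Set) : Fin m → Fin m → Set where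
    here : ∀ {x} → Reach H ok x x
    step : ∀ {x y z} (e : Edge) → H e → Joins e x y → ok y →
           Reach H ok y z → Reach H ok x z

  TwoConnected : Subgraph → Set
  TwoConnected H =
      (∃[ e ] H e)
    × (∀ x y → InV H x → InV H y → Reach H (λ _ → ⊤) x y)
    × (∀ z x y → InV H z → InV H x → InV H y → x ≢ z → y ≢ z →
         Reach H (λ w → w ≢ z) x y)

  TwoConnComponent : Subgraph → Set₁
  TwoConnComponent H =
    TwoConnected H × (∀ (K : Subgraph) → TwoConnected K → H ⊆ᴱ K → K ⊆ᴱ H)

  -- A simple cycle in G: closed walk vtx 0, vtx 1, …, vtx len = vtx 0 of length
  -- len ≥ 2 with pairwise distinct vertices vtx 0..vtx (len-1), whose i-th edge
  -- (between vtx i and vtx (i+1)) has color col i, and whose edges are pairwise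
  -- distinct (relevant for len = 2, where the two edges are parallel).
  record Cycle : Set where
    field
      len       : ℕ
      2≤len     : 2 ≤ len
      vtx       : Fin (1+ len) → Fin m
      col       : Fin len → Fin n
      closed    : vtx (fromℕ len) ≡ vtx zero
      distinctV : ∀ i j → vtx (inject₁ i) ≡ vtx (inject₁ j) → i ≡ j
      onJob     : ∀ i → vtx (inject₁ i) ∈ S (col i) × vtx (suc i) ∈ S (col i)
      distinctE : ∀ i j → i ≢ j →
                  ¬ (col i ≡ col j ×
                     SamePair (vtx (inject₁ i)) (vtx (suc i)) (vtx (inject₁ j)) (vtx (suc j)))

  open Cycle public

  HasRainbowCycle : Set
  HasRainbowCycle = Σ Cycle λ C → (∀ i j → Cycle.col C i ≡ Cycle.col C j → i ≡ j)

  HasMulticolorComponent : Set₁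
  HasMulticolorComponent =
    Σ Subgraph λ H → TwoConnComponent H ×
      (∃[ e ] ∃[ f ] (H e × H f × Edge.col e ≢ Edge.col f))

  HasMulticolorCycle : Set
  HasMulticolorCycle = Σ Cycle λ C → ∃[ i ] ∃[ j ] (Cycle.col C i ≢ Cycle.col C j)

-- Every job is a clique of G, so a walk can always be shortened inside a job.  All three
-- conditions meet in a bypass: a machine x lying in two jobs a ≢ b, together with a walk
-- avoiding x from a machine of job a to a machine of job b.  A multicolored cycle has one at
-- the first vertex where its color leaves that of its closing edge, and a multicolored block
-- has one at a vertex where two colors meet, the walk around it coming from 2-connectivity.
-- Conversely, when each vertex of the walk jumps to the last vertex sharing a job with it,
-- the vertices and the colors a, …, b become pairwise distinct; closing the walk through x
-- gives a rainbow cycle, and a cycle is 2-connected, so it lies in a block: the union of all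
-- 2-connected subgraphs containing it.

module Submission where

open import Defs
open import Data.Nat using (ℕ; zero; suc; z≤n; s≤s) renaming (_≤_ to _≤ℕ_)
open import Data.Fin using (Fin; zero; suc; fromℕ; inject₁)
open import Data.Fin.Properties using (_≟_; <-cmp; <⇒≢; 0≢1+n; fromℕ≢inject₁; inject₁-injective; suc-injective)
open import Data.Fin.Subset using () renaming (_∈_ to _∈ₛ_)
open import Data.Fin.Subset.Properties using () renaming (_∈?_ to _∈ₛ?_)
open import Data.List using (List; []; _∷_; _++_; [_]; length; lookup; concat; map; allFin; tabulate)
open import Data.List.Properties using (map-++)
open import Data.List.Relation.Unary.All as All using (All; []; _∷_)
open import Data.List.Relation.Unary.Any using (Any; here; there)
open import Data.List.Relation.Unary.Any.Properties as Any using ()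
open import Data.List.Relation.Unary.AllPairs using ([]; _∷_)
open import Data.List.Relation.Unary.Unique.Propositional using (Unique)
open import Data.List.Relation.Unary.Unique.Propositional.Properties as Unique using ()
open import Data.List.Relation.Binary.Subset.Propositional using (_⊆_)
open import Data.List.Membership.Propositional using (_∈_; _∉_)
open import Data.List.Membership.Propositional.Properties
  using (∈-lookup; ∈-++⁻; ∈-++⁺ˡ; ∈-++⁺ʳ; ∈-concat⁻′; ∈-concat⁺′; ∈-map⁻; ∈-map⁺; ∈-allFin)
open import Data.Product using (Σ; Σ-syntax; _×_; _,_; proj₁; proj₂)
open import Data.Sum using (_⊎_; inj₁; inj₂)
open import Data.Empty using (⊥-elim)
open import Data.Unit using (⊤; tt)
open import Function using (_∘_; id)
open import Function.Bundles using (_⇔_; mk⇔)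
open import Relation.Nullary using (¬_; yes; no)
open import Relation.Binary using (tri<; tri≈; tri>)
open import Relation.Binary.PropositionalEquality using (_≡_; _≢_; refl; sym; trans; cong; cong₂; subst; ≢-sym)

private
  variable
    A : Set
    d : A
    ds : List A

∉⇒All≢ : d ∉ ds → All (_≢ d) ds
∉⇒All≢ {ds = []}     _   = []
∉⇒All≢ {ds = _ ∷ ds} d∉ = (λ eq → d∉ (here (sym eq))) ∷ ∉⇒All≢ (d∉ ∘ there)

All≢⇒∉ : All (_≢ d) ds → d ∉ ds
All≢⇒∉ (d≢ ∷ _)    (here refl) = d≢ refl
All≢⇒∉ (_  ∷ d≢s) (there d∈)  = All≢⇒∉ d≢s d∈

Unique-∉ : Unique (d ∷ ds) → d ∉ ds
Unique-∉ (d≢ ∷ _) = All≢⇒∉ (All.map ≢-sym d≢)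

∉-Unique : d ∉ ds → Unique ds → Unique (d ∷ ds)
∉-Unique d∉ u = All.map ≢-sym (∉⇒All≢ d∉) ∷ u

lookup-injective : Unique ds → ∀ i j → lookup ds i ≡ lookup ds j → i ≡ j
lookup-injective (_  ∷ _) zero    zero    _  = refl
lookup-injective (d≢ ∷ _) zero    (suc j) eq = ⊥-elim (All.lookup d≢ (∈-lookup j) eq)
lookup-injective (d≢ ∷ _) (suc i) zero    eq = ⊥-elim (All.lookup d≢ (∈-lookup i) (sym eq))
lookup-injective (_  ∷ u) (suc i) (suc j) eq = cong suc (lookup-injective u i j eq)

inject₁≢suc : ∀ {k} (i : Fin k) → inject₁ i ≢ suc i
inject₁≢suc zero    ()
inject₁≢suc (suc i) eq = inject₁≢suc i (suc-injective eq)

inject₁-or-fromℕ : ∀ {k} (i : Fin (suc k)) → i ≡ fromℕ k ⊎ Σ[ j ∈ Fin k ] inject₁ j ≡ i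
inject₁-or-fromℕ {zero}  zero    = inj₁ refl
inject₁-or-fromℕ {suc k} zero    = inj₂ (zero , refl)
inject₁-or-fromℕ {suc k} (suc i) with inject₁-or-fromℕ i
... | inj₁ i≡k      = inj₁ (cong suc i≡k)
... | inj₂ (j , eq) = inj₂ (suc j , cong suc eq)

module _ {n m : ℕ} (S : OpenShop n m) where

  open import Data.List.Membership.DecPropositional (_≟_ {m}) using (_∈?_)

  private
    variable
      c : Fin n
      p q r s t x y z z′ : Fin m
      e f : Edge S
      H K K₀ : Subgraph S
      ok ok′ : Fin m → Set

  Incident : Edge S → Fin m → Set
  Incident e p = Edge.u e ≡ p ⊎ Edge.v e ≡ p

  Joins-sym : ∀ e → Joins S e p q → Joins S e q p
  Joins-sym _ (inj₁ (u≡ , v≡)) = inj₂ (u≡ , v≡)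
  Joins-sym _ (inj₂ (u≡ , v≡)) = inj₁ (u≡ , v≡)

  Joins⇒≢ : ∀ e → Joins S e p q → p ≢ q
  Joins⇒≢ (edge _ _ _ u<v _ _) (inj₁ (refl , refl)) = <⇒≢ u<v
  Joins⇒≢ (edge _ _ _ u<v _ _) (inj₂ (refl , refl)) = <⇒≢ u<v ∘ sym

  Joins⇒∈job : ∀ e → Joins S e p q → p ∈ₛ S (Edge.col e) × q ∈ₛ S (Edge.col e)
  Joins⇒∈job (edge _ _ _ _ u∈ v∈) (inj₁ (refl , refl)) = u∈ , v∈
  Joins⇒∈job (edge _ _ _ _ u∈ v∈) (inj₂ (refl , refl)) = v∈ , u∈

  Joins⇒Incidentˡ : ∀ e → Joins S e p q → Incident e p
  Joins⇒Incidentˡ _ (inj₁ (u≡ , _)) = inj₁ u≡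
  Joins⇒Incidentˡ _ (inj₂ (_ , v≡)) = inj₂ v≡

  Joins⇒Incidentʳ : ∀ e → Joins S e p q → Incident e q
  Joins⇒Incidentʳ e = Joins⇒Incidentˡ e ∘ Joins-sym e

  Incident⇒Joins : ∀ e → Incident e p → Σ[ q ∈ Fin m ] Joins S e p q
  Incident⇒Joins e (inj₁ u≡) = Edge.v e , inj₁ (u≡ , refl)
  Incident⇒Joins e (inj₂ v≡) = Edge.u e , inj₂ (refl , v≡)

  Incident²⇒Joins : ∀ e → Incident e p → Incident e q → p ≡ q ⊎ Joins S e p q
  Incident²⇒Joins _ (inj₁ u≡p) (inj₁ u≡q) = inj₁ (trans (sym u≡p) u≡q)
  Incident²⇒Joins _ (inj₁ u≡p) (inj₂ v≡q) = inj₂ (inj₁ (u≡p , v≡q))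
  Incident²⇒Joins _ (inj₂ v≡p) (inj₁ u≡q) = inj₂ (inj₂ (u≡q , v≡p))
  Incident²⇒Joins _ (inj₂ v≡p) (inj₂ v≡q) = inj₁ (trans (sym v≡p) v≡q)

  Joins-Incident : ∀ e → Joins S e p q → Incident e r → r ≡ p ⊎ r ≡ q
  Joins-Incident _ (inj₁ (u≡ , _)) (inj₁ u≡r) = inj₁ (trans (sym u≡r) u≡)
  Joins-Incident _ (inj₁ (_ , v≡)) (inj₂ v≡r) = inj₂ (trans (sym v≡r) v≡)
  Joins-Incident _ (inj₂ (u≡ , _)) (inj₁ u≡r) = inj₂ (trans (sym u≡r) u≡)
  Joins-Incident _ (inj₂ (_ , v≡)) (inj₂ v≡r) = inj₁ (trans (sym v≡r) v≡)

  endpoint-≢ : (e : Edge S) (z : Fin m) → Σ[ p ∈ Fin m ] Incident e p × p ≢ z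
  endpoint-≢ e z with Edge.u e ≟ z
  ... | no  u≢z = Edge.u e , inj₁ refl , u≢z
  ... | yes refl = Edge.v e , inj₂ refl , ≢-sym (Joins⇒≢ e (inj₁ (refl , refl)))

  jobEdge : p ≢ q → p ∈ₛ S c → q ∈ₛ S c → Σ[ e ∈ Edge S ] Edge.col e ≡ c × Joins S e p q
  jobEdge {p} {q} {c} p≢q p∈ q∈ with <-cmp p q
  ... | tri< p<q _ _ = edge c p q p<q p∈ q∈ , refl , inj₁ (refl , refl)
  ... | tri≈ _ p≡q _ = ⊥-elim (p≢q p≡q)
  ... | tri> _ _ q<p = edge c q p q<p q∈ p∈ , refl , inj₂ (refl , refl)

  data Walk : Fin m → Fin m → Set where
    nil  : Walk x x
    cons : ∀ e → Joins S e x y → Walk y z → Walk x z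

  vertices⁺ : Walk x y → List (Fin m)
  vertices⁺ nil                  = []
  vertices⁺ (cons {y = y} _ _ w) = y ∷ vertices⁺ w

  vertices : Walk x y → List (Fin m)
  vertices {x} w = x ∷ vertices⁺ w

  edges : Walk x y → List (Edge S)
  edges nil          = []
  edges (cons e _ w) = e ∷ edges w

  colors : Walk x y → List (Fin n)
  colors = map Edge.col ∘ edges

  _++ᵂ_ : Walk x y → Walk y z → Walk x z
  nil        ++ᵂ w′ = w′
  cons e j w ++ᵂ w′ = cons e j (w ++ᵂ w′)

  vertices⁺-++ᵂ : (w : Walk x y) (w′ : Walk y z) → vertices⁺ (w ++ᵂ w′) ≡ vertices⁺ w ++ vertices⁺ w′
  vertices⁺-++ᵂ nil          w′ = refl
  vertices⁺-++ᵂ (cons _ _ w) w′ = cong (_ ∷_) (vertices⁺-++ᵂ w w′)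

  edges-++ᵂ : (w : Walk x y) (w′ : Walk y z) → edges (w ++ᵂ w′) ≡ edges w ++ edges w′
  edges-++ᵂ nil          w′ = refl
  edges-++ᵂ (cons e _ w) w′ = cong (e ∷_) (edges-++ᵂ w w′)

  colors-++ᵂ : (w : Walk x y) (w′ : Walk y z) → colors (w ++ᵂ w′) ≡ colors w ++ colors w′
  colors-++ᵂ w w′ = trans (cong (map Edge.col) (edges-++ᵂ w w′)) (map-++ Edge.col (edges w) (edges w′))

  end∈vertices : (w : Walk x y) → y ∈ vertices w
  end∈vertices nil          = here refl
  end∈vertices (cons _ _ w) = there (end∈vertices w)

  Incident⇒∈vertices : (w : Walk x y) → e ∈ edges w → Incident e p → p ∈ vertices w
  Incident⇒∈vertices (cons e j w) (here refl) e∋p with Joins-Incident e j e∋p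
  ... | inj₁ refl = here refl
  ... | inj₂ refl = there (here refl)
  Incident⇒∈vertices (cons _ _ w) (there e∈) e∋p = there (Incident⇒∈vertices w e∈ e∋p)

  ∈vertices⁺⇒Incident : (w : Walk x y) → p ∈ vertices⁺ w → Σ[ e ∈ Edge S ] e ∈ edges w × Incident e p
  ∈vertices⁺⇒Incident (cons e j w) (here refl) = e , here refl , Joins⇒Incidentʳ e j
  ∈vertices⁺⇒Incident (cons _ _ w) (there p∈) with ∈vertices⁺⇒Incident w p∈
  ... | e , e∈ , e∋p = e , there e∈ , e∋p

  ∈vertices⁺⇒∈job : (w : Walk x y) → p ∈ vertices⁺ w → Σ[ c ∈ Fin n ] c ∈ colors w × p ∈ₛ S c
  ∈vertices⁺⇒∈job (cons e j w) (here refl) = Edge.col e , here refl , proj₂ (Joins⇒∈job e j)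
  ∈vertices⁺⇒∈job (cons _ _ w) (there p∈) with ∈vertices⁺⇒∈job w p∈
  ... | c , c∈ , p∈c = c , there c∈ , p∈c

  Walk⇒Reach : (w : Walk x y) → All H (edges w) → All ok (vertices⁺ w) → Reach S H ok x y
  Walk⇒Reach nil          []       []       = here
  Walk⇒Reach (cons e j w) (h ∷ hs) (o ∷ os) = step e h j o (Walk⇒Reach w hs os)

  Reach-trans : Reach S H ok x y → Reach S H ok y z → Reach S H ok x z
  Reach-trans here             r′ = r′
  Reach-trans (step e h j o r) r′ = step e h j o (Reach-trans r r′)

  Reach-sym : Reach S H ok x y → ok x → Reach S H ok y x
  Reach-sym here             _  = here
  Reach-sym (step e h j o r) ox = Reach-trans (Reach-sym r o) (step e h (Joins-sym e j) ox here)

  Reach-mono : (∀ e → H e → K e) → (∀ {w} → ok w → ok′ w) → Reach S H ok x y → Reach S K ok′ x y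
  Reach-mono H⊆K ok⇒ok′ here             = here
  Reach-mono H⊆K ok⇒ok′ (step e h j o r) = step e (H⊆K e h) j (ok⇒ok′ o) (Reach-mono H⊆K ok⇒ok′ r)

  Walk⇒Reach-from : (w : Walk s t) → p ∈ vertices w → All H (edges w) → All ok (vertices w) → Reach S H ok p t
  Walk⇒Reach-from w            (here refl) hs (_ ∷ os) = Walk⇒Reach w hs os
  Walk⇒Reach-from (cons _ _ w) (there p∈)  (_ ∷ hs) (_ ∷ os) = Walk⇒Reach-from w p∈ hs os

  record Path (H : Subgraph S) (ok : Fin m → Set) (x y : Fin m) : Set where
    field
      walk         : Walk x y
      unique       : Unique (vertices walk)
      edges∈       : All H (edges walk)
      vertices⁺-ok : All ok (vertices⁺ walk)

  Path-suffix : (w : Walk p y) → Unique (vertices w) → All H (edges w) → All ok (vertices⁺ w) →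
                x ∈ vertices w → Path H ok x y
  Path-suffix w u hs os (here refl) = record { walk = w ; unique = u ; edges∈ = hs ; vertices⁺-ok = os }
  Path-suffix nil _ _ _ (there ())
  Path-suffix (cons _ _ w) (_ ∷ u) (_ ∷ hs) (_ ∷ os) (there x∈) = Path-suffix w u hs os x∈

  Reach⇒Path : Reach S H ok x y → Path H ok x y
  Reach⇒Path here = record { walk = nil ; unique = [] ∷ [] ; edges∈ = [] ; vertices⁺-ok = [] }
  Reach⇒Path {x = x} (step e h j o r) with Reach⇒Path r
  ... | record { walk = w ; unique = u ; edges∈ = hs ; vertices⁺-ok = os } with x ∈? vertices w
  ...   | yes x∈ = Path-suffix w u hs os x∈
  ...   | no  x∉ = record { walk = cons e j w ; unique = ∉-Unique x∉ u ; edges∈ = h ∷ hs ; vertices⁺-ok = o ∷ os }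

  -- z occurs at most once on a path, so p reaches one of its ends without meeting z.
  Path-escape : (w : Walk s t) → Unique (vertices w) → All H (edges w) → p ∈ vertices w → p ≢ z →
                (Reach S H (_≢ z) p t × t ≢ z) ⊎ (Reach S H (_≢ z) p s × s ≢ z)
  Path-escape nil          _ _ (here refl) p≢z = inj₁ (here , p≢z)
  Path-escape (cons _ _ _) _ _ (here refl) p≢z = inj₂ (here , p≢z)
  Path-escape {s = s} {z = z} (cons e j w) u@(_ ∷ uw) (h ∷ hs) (there p∈) p≢z with Path-escape w uw hs p∈ p≢z
  ... | inj₁ to-t = inj₁ to-t
  ... | inj₂ (to-s′ , _) with s ≟ z
  ...   | no  s≢z  = inj₂ (Reach-trans to-s′ (step e h (Joins-sym e j) s≢z here) , s≢z)
  ...   | yes refl =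
    inj₁ (Walk⇒Reach-from w p∈ hs (∉⇒All≢ s∉) , λ t≡s → s∉ (subst (_∈ vertices w) t≡s (end∈vertices w)))
    where s∉ = Unique-∉ u

  ⟨_⟩ : List (Edge S) → Subgraph S
  ⟨ L ⟩ e = e ∈ L

  ⟨⟩-mono : {L L′ : List (Edge S)} → L ⊆ L′ → ∀ e → ⟨ L ⟩ e → ⟨ L′ ⟩ e
  ⟨⟩-mono L⊆L′ _ = L⊆L′

  TwoConnected-single : ∀ g → TwoConnected S ⟨ [ g ] ⟩
  TwoConnected-single g = (g , here refl) , connected , cut
    where
      connected : ∀ x y → InV S ⟨ [ g ] ⟩ x → InV S ⟨ [ g ] ⟩ y → Reach S ⟨ [ g ] ⟩ (λ _ → ⊤) x y
      connected x y (_ , here refl , g∋x) (_ , here refl , g∋y) with Incident²⇒Joins g g∋x g∋y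
      ... | inj₁ refl = here
      ... | inj₂ j    = step g (here refl) j tt here
      cut : ∀ z x y → InV S ⟨ [ g ] ⟩ z → InV S ⟨ [ g ] ⟩ x → InV S ⟨ [ g ] ⟩ y → x ≢ z → y ≢ z →
            Reach S ⟨ [ g ] ⟩ (λ w → w ≢ z) x y
      cut z x y (_ , here refl , g∋z) (_ , here refl , g∋x) (_ , here refl , g∋y) x≢z y≢z
        with Incident²⇒Joins g g∋x g∋y
      ... | inj₁ refl = here
      ... | inj₂ j with Joins-Incident g j g∋z
      ...   | inj₁ z≡x = ⊥-elim (x≢z (sym z≡x))
      ...   | inj₂ z≡y = ⊥-elim (y≢z (sym z≡y))

  -- z ∉ V(K) is undecidable for an arbitrary K, but it suffices to look for z on one connecting walk.
  TwoConnected⇒Reach-avoiding : TwoConnected S K → InV S K s → InV S K t → s ≢ z → t ≢ z → Reach S K (_≢ z) s t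
  TwoConnected⇒Reach-avoiding {z = z} (_ , connected , cut) s∈ t∈ s≢z t≢z with Reach⇒Path (connected _ _ s∈ t∈)
  ... | record { walk = w ; edges∈ = ks } with z ∈? vertices⁺ w
  ...   | no  z∉ = Walk⇒Reach w ks (∉⇒All≢ z∉)
  ...   | yes z∈ with ∈vertices⁺⇒Incident w z∈
  ...     | e , e∈ , e∋z = cut z _ _ (e , All.lookup ks e∈ , e∋z) s∈ t∈ s≢z t≢z

  Anchored : Subgraph S → Subgraph S → Fin m → Fin m → Set
  Anchored K K₀ w z = Σ[ c ∈ Fin m ] InV S K₀ c × c ≢ z × Reach S K (_≢ z) w c

  TwoConnected-grow : (∀ e → K₀ e → K e) → TwoConnected S K₀ →
                      (∀ w z → InV S K w → w ≢ z → Anchored K K₀ w z) → TwoConnected S K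
  TwoConnected-grow {K₀ = K₀} {K = K} K₀⊆K tc₀@((e , e∈) , connected₀ , _) anchored =
    (e , K₀⊆K e e∈) , connected , cut
    where
      lift : Reach S K₀ ok x y → Reach S K ok x y
      lift = Reach-mono K₀⊆K id
      -- Only the path into K₀ matters here, so any z ≢ x will do, e.g. a neighbour of x.
      connected : ∀ x y → InV S K x → InV S K y → Reach S K (λ _ → ⊤) x y
      connected x y x∈@(ex , _ , ex∋x) y∈@(ey , _ , ey∋y) with Incident⇒Joins ex ex∋x | Incident⇒Joins ey ey∋y
      ... | x′ , jx | y′ , jy with anchored x x′ x∈ (Joins⇒≢ ex jx) | anchored y y′ y∈ (Joins⇒≢ ey jy)
      ...   | c , c∈ , _ , x→c | d , d∈ , _ , y→d =
        Reach-trans (Reach-mono (λ _ → id) _ x→c)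
          (Reach-trans (lift (connected₀ c d c∈ d∈)) (Reach-sym (Reach-mono (λ _ → id) _ y→d) tt))
      cut : ∀ z x y → InV S K z → InV S K x → InV S K y → x ≢ z → y ≢ z → Reach S K (λ w → w ≢ z) x y
      cut z x y _ x∈ y∈ x≢z y≢z with anchored x z x∈ x≢z | anchored y z y∈ y≢z
      ... | c , c∈ , c≢z , x→c | d , d∈ , d≢z , y→d =
        Reach-trans x→c (Reach-trans (lift (TwoConnected⇒Reach-avoiding tc₀ c∈ d∈ c≢z d≢z)) (Reach-sym y→d y≢z))

  circuit-TwoConnected : ∀ g → Joins S g x q → (w : Walk q x) → Unique (vertices w) →
                         TwoConnected S ⟨ g ∷ edges w ⟩
  circuit-TwoConnected {x} {q} g j w u =
    TwoConnected-grow (⟨⟩-mono λ { (here refl) → here refl }) (TwoConnected-single g) anchored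
    where
      anchored : ∀ p z → InV S ⟨ g ∷ edges w ⟩ p → p ≢ z → Anchored ⟨ g ∷ edges w ⟩ ⟨ [ g ] ⟩ p z
      anchored p z (_ , here refl , g∋p) p≢z = p , (g , here refl , g∋p) , p≢z , here
      anchored p z (e , there e∈ , e∋p) p≢z
        with Path-escape w u (All.tabulate there) (Incident⇒∈vertices w e∈ e∋p) p≢z
      ... | inj₁ (p→x , x≢z) = x , (g , here refl , Joins⇒Incidentˡ g j) , x≢z , p→x
      ... | inj₂ (p→q , q≢z) = q , (g , here refl , Joins⇒Incidentʳ g j) , q≢z , p→q

  -- An edge f of K joins L₀ in a finite 2-connected subgraph: f with, for each endpoint and
  -- each z, a path in K − z from the endpoint to L₀.
  module _ {K : Subgraph S} (tcK : TwoConnected S K)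
           {L₀ : List (Edge S)} (tc₀ : TwoConnected S ⟨ L₀ ⟩) (L₀⊆K : ∀ e → e ∈ L₀ → K e) where

    private
      g₀ : Edge S
      g₀ = proj₁ (proj₁ tc₀)

      g∈L₀ : g₀ ∈ L₀
      g∈L₀ = proj₂ (proj₁ tc₀)

      record Escape (s z : Fin m) : Set where
        field
          end    : Fin m
          end∈g₀ : Incident g₀ end
          end≢z  : end ≢ z
          walk   : Walk s end
          unique : Unique (vertices walk)
          avoids : s ≢ z → All (_≢ z) (vertices⁺ walk)
      open Escape

      escape : InV S K s → (z : Fin m) → Escape s z
      escape {s} s∈ z with endpoint-≢ g₀ z
      ... | c , g∋c , c≢z with s ≟ z
      ...   | yes s≡z = record { end = c ; end∈g₀ = g∋c ; end≢z = c≢z ; walk = Path.walk P ; unique = Path.unique P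
                               ; avoids = λ s≢z → ⊥-elim (s≢z s≡z) }
        where P = Reach⇒Path (proj₁ (proj₂ tcK) s c s∈ (g₀ , L₀⊆K g₀ g∈L₀ , g∋c))
      ...   | no  s≢z = record { end = c ; end∈g₀ = g∋c ; end≢z = c≢z ; walk = Path.walk P ; unique = Path.unique P
                               ; avoids = λ _ → Path.vertices⁺-ok P }
        where P = Reach⇒Path (TwoConnected⇒Reach-avoiding tcK s∈ (g₀ , L₀⊆K g₀ g∈L₀ , g∋c) s≢z c≢z)

      routes : InV S K s → List (Edge S)
      routes s∈ = concat (map (λ z → edges (walk (escape s∈ z))) (allFin m))

      ∈routes⁺ : (s∈ : InV S K s) → e ∈ edges (walk (escape s∈ z)) → e ∈ routes s∈
      ∈routes⁺ {z = z} s∈ e∈ = ∈-concat⁺′ e∈ (∈-map⁺ (λ z → edges (walk (escape s∈ z))) (∈-allFin z))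

      ∈routes⁻ : (s∈ : InV S K s) → e ∈ routes s∈ → Σ[ z ∈ Fin m ] e ∈ edges (walk (escape s∈ z))
      ∈routes⁻ s∈ e∈ with ∈-concat⁻′ (map (λ z → edges (walk (escape s∈ z))) (allFin m)) e∈
      ... | _ , e∈es , es∈ with ∈-map⁻ (λ z → edges (walk (escape s∈ z))) es∈
      ...   | z , _ , refl = z , e∈es

    module _ {f : Edge S} (Kf : K f) where

      private
        u∈K : InV S K (Edge.u f)
        u∈K = f , Kf , inj₁ refl

        v∈K : InV S K (Edge.v f)
        v∈K = f , Kf , inj₂ refl

        L : List (Edge S)
        L = L₀ ++ f ∷ routes u∈K ++ routes v∈K

        Routed : InV S K s → Set
        Routed s∈ = ∀ {e} → e ∈ routes s∈ → e ∈ L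

        routed-u : Routed u∈K
        routed-u = ∈-++⁺ʳ L₀ ∘ there ∘ ∈-++⁺ˡ

        routed-v : Routed v∈K
        routed-v = ∈-++⁺ʳ L₀ ∘ there ∘ ∈-++⁺ʳ (routes u∈K)

        from-start : (s∈ : InV S K s) → Routed s∈ → s ≢ z → Anchored ⟨ L ⟩ ⟨ L₀ ⟩ s z
        from-start {z = z} s∈ routed s≢z =
          end E , (g₀ , g∈L₀ , end∈g₀ E) , end≢z E ,
          Walk⇒Reach (walk E) (All.tabulate (routed ∘ ∈routes⁺ s∈)) (avoids E s≢z)
          where E = escape s∈ z

        from-route : (s∈ : InV S K s) → Routed s∈ → e ∈ edges (walk (escape s∈ z′)) → Incident e p → p ≢ z →
                     Anchored ⟨ L ⟩ ⟨ L₀ ⟩ p z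
        from-route {z′ = z′} s∈ routed e∈ e∋p p≢z
          with Path-escape (walk (escape s∈ z′)) (unique (escape s∈ z′)) (All.tabulate (routed ∘ ∈routes⁺ s∈))
                           (Incident⇒∈vertices (walk (escape s∈ z′)) e∈ e∋p) p≢z
        ... | inj₁ (p→c , c≢z) = end (escape s∈ z′) , (g₀ , g∈L₀ , end∈g₀ (escape s∈ z′)) , c≢z , p→c
        ... | inj₂ (p→s , s≢z) with from-start s∈ routed s≢z
        ...   | c , c∈ , c≢z , s→c = c , c∈ , c≢z , Reach-trans p→s s→c

        anchored : ∀ p z → InV S ⟨ L ⟩ p → p ≢ z → Anchored ⟨ L ⟩ ⟨ L₀ ⟩ p z
        anchored p z (e , e∈L , e∋p) p≢z with ∈-++⁻ L₀ e∈L
        ... | inj₁ e∈L₀ = p , (e , e∈L₀ , e∋p) , p≢z , here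
        ... | inj₂ (here refl) with e∋p
        ...   | inj₁ refl = from-start u∈K routed-u p≢z
        ...   | inj₂ refl = from-start v∈K routed-v p≢z
        anchored p z (e , e∈L , e∋p) p≢z | inj₂ (there e∈rs) with ∈-++⁻ (routes u∈K) e∈rs
        ... | inj₁ e∈ru = let z′ , e∈ = ∈routes⁻ u∈K e∈ru in from-route {z′ = z′} u∈K routed-u e∈ e∋p p≢z
        ... | inj₂ e∈rv = let z′ , e∈ = ∈routes⁻ v∈K e∈rv in from-route {z′ = z′} v∈K routed-v e∈ e∋p p≢z


      TwoConnected-absorb : Σ[ L′ ∈ List (Edge S) ] TwoConnected S ⟨ L′ ⟩ × L₀ ⊆ L′ × f ∈ L′
      TwoConnected-absorb = L , TwoConnected-grow (⟨⟩-mono ∈-++⁺ˡ) tc₀ anchored , ∈-++⁺ˡ , ∈-++⁺ʳ L₀ (here refl)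

  module _ {L₀ : List (Edge S)} (tc₀ : TwoConnected S ⟨ L₀ ⟩) where

    -- Lists of edges witness the members, which keeps the union of all 2-connected subgraphs in Set.
    Block : Subgraph S
    Block e = Σ[ L ∈ List (Edge S) ] TwoConnected S ⟨ L ⟩ × L₀ ⊆ L × e ∈ L

    L₀⊆Block : ∀ e → e ∈ L₀ → Block e
    L₀⊆Block _ e∈ = L₀ , tc₀ , id , e∈

    private
      g₀ : Edge S
      g₀ = proj₁ (proj₁ tc₀)

      g∈L₀ : g₀ ∈ L₀
      g∈L₀ = proj₂ (proj₁ tc₀)

      into-Block : {L : List (Edge S)} → TwoConnected S ⟨ L ⟩ → L₀ ⊆ L → Reach S ⟨ L ⟩ ok x y → Reach S Block ok x y
      into-Block tc L₀⊆L = Reach-mono (λ _ e∈ → _ , tc , L₀⊆L , e∈) id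

    Block-TwoConnected : TwoConnected S Block
    Block-TwoConnected = (g₀ , L₀⊆Block g₀ g∈L₀) , connected , cut
      where
        to-g₀ : InV S Block x → Reach S Block (λ _ → ⊤) x (Edge.u g₀)
        to-g₀ (e , (L , tc , L₀⊆L , e∈L) , e∋x) =
          into-Block tc L₀⊆L (proj₁ (proj₂ tc) _ _ (e , e∈L , e∋x) (g₀ , L₀⊆L g∈L₀ , inj₁ refl))

        to-g₀-avoiding : InV S Block x → Incident g₀ p → x ≢ z → p ≢ z → Reach S Block (_≢ z) x p
        to-g₀-avoiding (e , (L , tc , L₀⊆L , e∈L) , e∋x) g∋p x≢z p≢z =
          into-Block tc L₀⊆L (TwoConnected⇒Reach-avoiding tc (e , e∈L , e∋x) (g₀ , L₀⊆L g∈L₀ , g∋p) x≢z p≢z)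

        connected : ∀ x y → InV S Block x → InV S Block y → Reach S Block (λ _ → ⊤) x y
        connected x y x∈ y∈ = Reach-trans (to-g₀ x∈) (Reach-sym (to-g₀ y∈) tt)

        cut : ∀ z x y → InV S Block z → InV S Block x → InV S Block y → x ≢ z → y ≢ z →
              Reach S Block (λ w → w ≢ z) x y
        cut z x y _ x∈ y∈ x≢z y≢z with endpoint-≢ g₀ z
        ... | c , g∋c , c≢z =
          Reach-trans (to-g₀-avoiding x∈ g∋c x≢z c≢z) (Reach-sym (to-g₀-avoiding y∈ g∋c y≢z c≢z) y≢z)

    Block-component : TwoConnComponent S Block
    Block-component = Block-TwoConnected , maximal
      where
        maximal : ∀ K → TwoConnected S K → (∀ e → Block e → K e) → ∀ e → K e → Block e
        maximal K tcK Block⊆K e Ke = TwoConnected-absorb tcK tc₀ (λ e′ → Block⊆K e′ ∘ L₀⊆Block e′) Ke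

  record RainbowCircuit : Set where
    field
      {apex start}  : Fin m
      closing       : Edge S
      closing-joins : Joins S closing apex start
      path          : Walk start apex
      path-unique   : Unique (vertices path)
      rainbow       : Unique (Edge.col closing ∷ colors path)

  RainbowCircuit⇒multicolorComponent : RainbowCircuit → HasMulticolorComponent S
  RainbowCircuit⇒multicolorComponent record { closing = g ; closing-joins = j ; path = nil } = ⊥-elim (Joins⇒≢ g j refl)
  RainbowCircuit⇒multicolorComponent
    record { closing = g ; closing-joins = j ; path = path@(cons e _ _) ; path-unique = u ; rainbow = (g≢e ∷ _) ∷ _ } =
    Block tc , Block-component tc , g , e , L₀⊆Block tc g (here refl) , L₀⊆Block tc e (there (here refl)) , g≢e
    where tc = circuit-TwoConnected g j path u

  vertexAt : (w : Walk x y) → Fin (suc (length (colors w))) → Fin m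
  vertexAt {x} w            zero    = x
  vertexAt     (cons _ _ w) (suc i) = vertexAt w i

  vertexAt-∈ : (w : Walk x y) → ∀ i → vertexAt w i ∈ vertices w
  vertexAt-∈ w            zero    = here refl
  vertexAt-∈ (cons _ _ w) (suc i) = there (vertexAt-∈ w i)

  vertexAt-last : (w : Walk x y) → vertexAt w (fromℕ (length (colors w))) ≡ y
  vertexAt-last nil          = refl
  vertexAt-last (cons _ _ w) = vertexAt-last w

  vertexAt-injective : (w : Walk x y) → Unique (vertices w) → ∀ i j → vertexAt w i ≡ vertexAt w j → i ≡ j
  vertexAt-injective w            _        zero    zero    _  = refl
  vertexAt-injective (cons _ _ w) (x≢ ∷ _) zero    (suc j) eq = ⊥-elim (All.lookup x≢ (vertexAt-∈ w j) eq)
  vertexAt-injective (cons _ _ w) (x≢ ∷ _) (suc i) zero    eq = ⊥-elim (All.lookup x≢ (vertexAt-∈ w i) (sym eq))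
  vertexAt-injective (cons _ _ w) (_  ∷ u) (suc i) (suc j) eq = cong suc (vertexAt-injective w u i j eq)

  vertexAt-∈job : (w : Walk x y) → ∀ i →
                  vertexAt w (inject₁ i) ∈ₛ S (lookup (colors w) i) × vertexAt w (suc i) ∈ₛ S (lookup (colors w) i)
  vertexAt-∈job (cons e j w) zero    = Joins⇒∈job e j
  vertexAt-∈job (cons _ _ w) (suc i) = vertexAt-∈job w i

  Walk-nonempty : x ≢ y → (w : Walk x y) → 1 ≤ℕ length (colors w)
  Walk-nonempty x≢x nil          = ⊥-elim (x≢x refl)
  Walk-nonempty _   (cons _ _ _) = s≤s z≤n

  RainbowCircuit⇒rainbowCycle : RainbowCircuit → HasRainbowCycle S
  RainbowCircuit⇒rainbowCycle record { closing = g ; closing-joins = j ; path = P ; path-unique = u ; rainbow = rb } =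
    record
      { len       = length (colors C)
      ; 2≤len     = s≤s (Walk-nonempty (≢-sym (Joins⇒≢ g j)) P)
      ; vtx       = vertexAt C
      ; col       = lookup (colors C)
      ; closed    = vertexAt-last P
      ; distinctV = distinct
      ; onJob     = vertexAt-∈job C
      ; distinctE = λ i j i≢j (same-color , _) → i≢j (lookup-injective rb i j same-color)
      } , lookup-injective rb
    where
      C = cons g j P

      apex≢inner : ∀ i → vertexAt P (fromℕ _) ≢ vertexAt P (inject₁ i)
      apex≢inner i = fromℕ≢inject₁ {i = i} ∘ vertexAt-injective P u _ (inject₁ i)

      distinct : ∀ i j → vertexAt C (inject₁ i) ≡ vertexAt C (inject₁ j) → i ≡ j
      distinct zero    zero    _  = refl
      distinct zero    (suc j) eq = ⊥-elim (apex≢inner j (trans (vertexAt-last P) eq))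
      distinct (suc i) zero    eq = ⊥-elim (apex≢inner i (trans (vertexAt-last P) (sym eq)))
      distinct (suc i) (suc j) eq = cong suc (inject₁-injective (vertexAt-injective P u _ _ eq))

  record Bypass : Set where
    field
      hub         : Fin m
      a b         : Fin n
      a≢b         : a ≢ b
      hub∈a       : hub ∈ₛ S a
      hub∈b       : hub ∈ₛ S b
      {start end} : Fin m
      start∈a     : start ∈ₛ S a
      end∈b       : end ∈ₛ S b
      walk        : Walk start end
      hub∉walk    : hub ∉ vertices walk

  -- At the first edge leaving color c, its start lies in job c: it is p or the end of a c-colored edge.
  path⇒Bypass : (w : Walk p q) → Unique (vertices w) → p ∈ₛ S c → q ∈ₛ S c → Any (_≢ c) (colors w) → Bypass
  path⇒Bypass {c = c} (cons {x = p} e j w) u p∈c q∈c changes with Edge.col e ≟ c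
  ... | no  e≢c = record { hub = p ; a = Edge.col e ; b = _ ; a≢b = e≢c ; hub∈a = proj₁ (Joins⇒∈job e j) ; hub∈b = p∈c
                         ; start∈a = proj₂ (Joins⇒∈job e j) ; end∈b = q∈c ; walk = w ; hub∉walk = Unique-∉ u }
  ... | yes refl with changes
  ...   | here  e≢e = ⊥-elim (e≢e refl)
  ...   | there changes′ with u
  ...     | _ ∷ uw = path⇒Bypass w uw (proj₂ (Joins⇒∈job e j)) q∈c changes′

  sequenceWalk : ∀ {k} (v : Fin (suc k) → Fin m) (c : Fin k → Fin n) →
                 (∀ i → Σ[ e ∈ Edge S ] Edge.col e ≡ c i × Joins S e (v (inject₁ i)) (v (suc i))) →
                 Walk (v zero) (v (fromℕ k))
  sequenceWalk {zero}  v c link = nil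
  sequenceWalk {suc k} v c link =
    cons (proj₁ (link zero)) (proj₂ (proj₂ (link zero))) (sequenceWalk (v ∘ suc) (c ∘ suc) (link ∘ suc))

  vertices-sequenceWalk : ∀ {k} v c link → vertices (sequenceWalk {k} v c link) ≡ tabulate v
  vertices-sequenceWalk {zero}  v c link = refl
  vertices-sequenceWalk {suc k} v c link = cong (v zero ∷_) (vertices-sequenceWalk (v ∘ suc) (c ∘ suc) (link ∘ suc))

  colors-sequenceWalk : ∀ {k} v c link → colors (sequenceWalk {k} v c link) ≡ tabulate c
  colors-sequenceWalk {zero}  v c link = refl
  colors-sequenceWalk {suc k} v c link =
    cong₂ _∷_ (proj₁ (proj₂ (link zero))) (colors-sequenceWalk (v ∘ suc) (c ∘ suc) (link ∘ suc))

  -- The cycle without its last edge is a path whose two ends lie in the job b of that edge.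
  cycle⇒Bypass : ∀ {k} (vtx : Fin (suc (suc k)) → Fin m) (col : Fin (suc k) → Fin n) →
                 vtx (fromℕ (suc k)) ≡ vtx zero → (∀ i j → vtx (inject₁ i) ≡ vtx (inject₁ j) → i ≡ j) →
                 (∀ i → vtx (inject₁ i) ∈ₛ S (col i) × vtx (suc i) ∈ₛ S (col i)) →
                 ∀ i j → col i ≢ col j → Bypass
  cycle⇒Bypass {k} vtx col closed distinct onJob i j col-i≢col-j =
    path⇒Bypass path
      (subst Unique (sym (vertices-sequenceWalk _ _ link)) (Unique.tabulate⁺ (distinct _ _)))
      (subst (_∈ₛ S b) closed (proj₂ (onJob (fromℕ k))))
      (proj₁ (onJob (fromℕ k)))
      (subst (Any (_≢ b)) (sym (colors-sequenceWalk _ _ link)) (Any.tabulate⁺ _ (proj₂ (other-color))))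
    where
      b : Fin n
      b = col (fromℕ k)

      link : ∀ i → Σ[ e ∈ Edge S ] Edge.col e ≡ col (inject₁ i) ×
                                   Joins S e (vtx (inject₁ (inject₁ i))) (vtx (inject₁ (suc i)))
      link i = jobEdge (inject₁≢suc i ∘ distinct _ _) (proj₁ (onJob (inject₁ i))) (proj₂ (onJob (inject₁ i)))

      path : Walk (vtx zero) (vtx (inject₁ (fromℕ k)))
      path = sequenceWalk (vtx ∘ inject₁) (col ∘ inject₁) link

      not-last : ∀ l → col l ≢ b → Σ[ l′ ∈ Fin k ] col (inject₁ l′) ≢ b
      not-last l l≢b with inject₁-or-fromℕ l
      ... | inj₁ refl        = ⊥-elim (l≢b refl)
      ... | inj₂ (l′ , refl) = l′ , l≢b

      other-color : Σ[ l ∈ Fin k ] col (inject₁ l) ≢ b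
      other-color with col i ≟ b
      ... | no  i≢b = not-last i i≢b
      ... | yes i≡b = not-last j (λ j≡b → col-i≢col-j (trans i≡b (sym j≡b)))

  multicolorCycle⇒Bypass : HasMulticolorCycle S → Bypass
  multicolorCycle⇒Bypass
    (record { 2≤len = s≤s _ ; vtx = vtx ; col = col ; closed = closed ; distinctV = distinct ; onJob = onJob } ,
     i , j , col-i≢col-j) =
    cycle⇒Bypass vtx col closed distinct onJob i j col-i≢col-j

  record Corner (H : Subgraph S) : Set where
    constructor corner
    field
      hub     : Fin m
      e₁ e₂   : Edge S
      H∋e₁    : H e₁
      H∋e₂    : H e₂
      e₁∋hub  : Incident e₁ hub
      e₂∋hub  : Incident e₂ hub
      colors≢ : Edge.col e₁ ≢ Edge.col e₂

  Reach⇒Corner : Reach S H ok p r → H e → Incident e p → H f → Incident f r → Edge.col e ≢ Edge.col f → Corner H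
  Reach⇒Corner {p = p} {e = e} {f = f} here He e∋p Hf f∋p e≢f =
    corner p e f He Hf e∋p f∋p e≢f
  Reach⇒Corner {p = p} {e = e} (step e′ He′ j _ r) He e∋p Hf f∋r e≢f with Edge.col e ≟ Edge.col e′
  ... | no  e≢e′ = corner p e e′ He He′ e∋p (Joins⇒Incidentˡ e′ j) e≢e′
  ... | yes e≡e′ = Reach⇒Corner r He′ (Joins⇒Incidentʳ e′ j) Hf f∋r (e≢f ∘ trans e≡e′)

  multicolorComponent⇒Bypass : HasMulticolorComponent S → Bypass
  multicolorComponent⇒Bypass (H , ((_ , connected , cut) , _) , e , f , He , Hf , e≢f)
    with Reach⇒Corner (connected _ _ (e , He , inj₁ refl) (f , Hf , inj₁ refl)) He (inj₁ refl) Hf (inj₁ refl) e≢f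
  ... | corner x g h Hg Hh g∋x h∋x g≢h
    with Incident⇒Joins g g∋x | Incident⇒Joins h h∋x
  ...   | y , jg | y′ , jh =
    record { hub = x ; a = Edge.col g ; b = Edge.col h ; a≢b = g≢h
           ; hub∈a = proj₁ (Joins⇒∈job g jg) ; hub∈b = proj₁ (Joins⇒∈job h jh)
           ; start∈a = proj₂ (Joins⇒∈job g jg) ; end∈b = proj₂ (Joins⇒∈job h jh)
           ; walk = Path.walk P ; hub∉walk = All≢⇒∉ (y≢x ∷ Path.vertices⁺-ok P) }
    where
      y≢x = ≢-sym (Joins⇒≢ g jg)
      P = Reach⇒Path (cut x y y′ (g , Hg , g∋x) (g , Hg , Joins⇒Incidentʳ g jg) (h , Hh , Joins⇒Incidentʳ h jh)
                                  y≢x (≢-sym (Joins⇒≢ h jh)))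

  AvoidsJobs : Fin m → List (Fin n) → Set
  AvoidsJobs p = All (λ c → ¬ p ∈ₛ S c)

  NoShortcut : Fin n → Walk x y → Set
  NoShortcut b nil                  = ⊤
  NoShortcut b (cons {x = p} _ _ w) = ¬ p ∈ₛ S b × AvoidsJobs p (colors w) × NoShortcut b w

  data Suffix {t : Fin m} : Walk q t → Walk p t → Set where
    self : {w : Walk p t} → Suffix w w
    skip : {w′ : Walk q t} {w : Walk r t} {j : Joins S e p r} → Suffix w′ w → Suffix w′ (cons e j w)

  Suffix-vertices : {w′ : Walk q t} {w : Walk p t} → Suffix w′ w → vertices w′ ⊆ vertices w
  Suffix-vertices self     = id
  Suffix-vertices (skip s) = there ∘ Suffix-vertices s

  Suffix-NoShortcut : ∀ {b} {w′ : Walk q t} {w : Walk p t} → Suffix w′ w → NoShortcut b w → NoShortcut b w′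
  Suffix-NoShortcut self     ns           = ns
  Suffix-NoShortcut (skip s) (_ , _ , ns) = Suffix-NoShortcut s ns

  ∈colors⇒∈job : (w : Walk x y) → c ∈ colors w → Σ[ p ∈ Fin m ] p ∈ vertices⁺ w × p ∈ₛ S c
  ∈colors⇒∈job (cons {y = y} e j w) (here refl) = y , here refl , proj₂ (Joins⇒∈job e j)
  ∈colors⇒∈job (cons _ _ w) (there c∈) with ∈colors⇒∈job w c∈
  ... | p , p∈ , p∈c = p , there p∈ , p∈c

  NoShortcut⇒Unique : ∀ {b} (w : Walk x y) → NoShortcut b w → Unique (vertices w)
  NoShortcut⇒Unique nil _ = [] ∷ []
  NoShortcut⇒Unique (cons {x = p} e j w) (_ , avoids , ns) = ∉-Unique p∉ (NoShortcut⇒Unique w ns)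
    where
      p∉ : p ∉ vertices w
      p∉ (here p≡) = Joins⇒≢ e j p≡
      p∉ (there p∈) with ∈vertices⁺⇒∈job w p∈
      ... | c , c∈ , p∈c = All.lookup avoids c∈ p∈c

  NoShortcut⇒Unique-colors : ∀ {b} (w : Walk x y) → NoShortcut b w → Unique (colors w ++ [ b ])
  NoShortcut⇒Unique-colors nil _ = [] ∷ []
  NoShortcut⇒Unique-colors {b = b} (cons e j w) (p∉b , avoids , ns) = ∉-Unique e∉ (NoShortcut⇒Unique-colors w ns)
    where
      e∉ : Edge.col e ∉ colors w ++ [ b ]
      e∉ e∈ with ∈-++⁻ (colors w) e∈
      ... | inj₁ e∈w         = All.lookup avoids e∈w (proj₁ (Joins⇒∈job e j))
      ... | inj₂ (here refl) = p∉b (proj₁ (Joins⇒∈job e j))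

  record LastSharedJob (y : Fin m) (w : Walk p t) : Set where
    field
      {start}   : Fin m
      suffix    : Walk start t
      is-suffix : Suffix suffix w
      job       : Fin n
      y∈job     : y ∈ₛ S job
      start∈job : start ∈ₛ S job
      avoids    : AvoidsJobs y (colors suffix)

  lastSharedJob : ∀ y (w : Walk p t) → AvoidsJobs y (colors w) ⊎ LastSharedJob y w
  lastSharedJob y nil = inj₁ []
  lastSharedJob y (cons e j w) with lastSharedJob y w
  ... | inj₂ record { suffix = w′ ; is-suffix = sfx ; job = d ; y∈job = y∈d ; start∈job = q∈d ; avoids = avoids } =
    inj₂ (record { suffix = w′ ; is-suffix = skip sfx ; job = d ; y∈job = y∈d ; start∈job = q∈d ; avoids = avoids })
  ... | inj₁ avoids with y ∈ₛ? S (Edge.col e)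
  ...   | no  y∉e = inj₁ (y∉e ∷ avoids)
  ...   | yes y∈e = inj₂ (record { suffix = w ; is-suffix = skip self ; job = Edge.col e ; y∈job = y∈e
                                  ; start∈job = proj₂ (Joins⇒∈job e j) ; avoids = avoids })

  record Shortcut (b : Fin n) (w : Walk p t) : Set where
    field
      {end}       : Fin m
      walk        : Walk p end
      end∈b       : end ∈ₛ S b
      no-shortcut : NoShortcut b walk
      ⊆vertices   : vertices walk ⊆ vertices w

  -- Working from the end, each vertex jumps straight to the last vertex sharing a job with it.
  shortcut : ∀ b (w : Walk p t) → t ∈ₛ S b → Shortcut b w
  shortcut b nil t∈b = record { walk = nil ; end∈b = t∈b ; no-shortcut = tt ; ⊆vertices = id }
  shortcut b (cons {x = y} e j w) t∈b with y ∈ₛ? S b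
  ... | yes y∈b = record { walk = nil ; end∈b = y∈b ; no-shortcut = tt ; ⊆vertices = λ { (here refl) → here refl } }
  ... | no  y∉b with shortcut b w t∈b
  ...   | record { walk = w′ ; end∈b = t′∈b ; no-shortcut = ns ; ⊆vertices = w′⊆w } with lastSharedJob y w′
  ...     | inj₁ avoids = record { walk = cons e j w′ ; end∈b = t′∈b ; no-shortcut = y∉b , avoids , ns
                                 ; ⊆vertices = λ { (here refl) → here refl ; (there v∈) → there (w′⊆w v∈) } }
  ...     | inj₂ record { start = q ; suffix = w″ ; is-suffix = sfx ; y∈job = y∈d ; start∈job = q∈d ; avoids = avoids }
    with y ≟ q
  ...       | yes refl = record { walk = w″ ; end∈b = t′∈b ; no-shortcut = Suffix-NoShortcut sfx ns
                                ; ⊆vertices = there ∘ w′⊆w ∘ Suffix-vertices sfx }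
  ...       | no  y≢q  = record { walk = cons (proj₁ link) (proj₂ (proj₂ link)) w″ ; end∈b = t′∈b
                                ; no-shortcut = y∉b , avoids , Suffix-NoShortcut sfx ns
                                ; ⊆vertices = λ { (here refl) → here refl
                                                ; (there v∈) → there (w′⊆w (Suffix-vertices sfx v∈)) } }
    where link = jobEdge y≢q y∈d q∈d

  record LastInJob (a : Fin n) (w : Walk p t) : Set where
    field
      {start}   : Fin m
      suffix    : Walk start t
      is-suffix : Suffix suffix w
      start∈a   : start ∈ₛ S a
      leaves    : All (λ v → ¬ v ∈ₛ S a) (vertices⁺ suffix)

  lastInJob : ∀ a (w : Walk p t) → LastInJob a w ⊎ All (λ v → ¬ v ∈ₛ S a) (vertices w)
  lastInJob a (nil {x = p}) with p ∈ₛ? S a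
  ... | yes p∈a = inj₁ (record { suffix = nil ; is-suffix = self ; start∈a = p∈a ; leaves = [] })
  ... | no  p∉a = inj₂ (p∉a ∷ [])
  lastInJob a (cons {x = p} e j w) with lastInJob a w
  ... | inj₁ record { suffix = w′ ; is-suffix = sfx ; start∈a = q∈a ; leaves = leaves } =
    inj₁ (record { suffix = w′ ; is-suffix = skip sfx ; start∈a = q∈a ; leaves = leaves })
  ... | inj₂ none with p ∈ₛ? S a
  ...   | yes p∈a = inj₁ (record { suffix = cons e j w ; is-suffix = self ; start∈a = p∈a ; leaves = none })
  ...   | no  p∉a = inj₂ (p∉a ∷ none)

  outside-job⇒∉colors : (w : Walk x y) → All (λ v → ¬ v ∈ₛ S c) (vertices⁺ w) → c ∉ colors w
  outside-job⇒∉colors w leaves c∈ with ∈colors⇒∈job w c∈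
  ... | p , p∈ , p∈c = All.lookup leaves p∈ p∈c

  Rainbow : Bypass → Set
  Rainbow B = Unique (vertices walk) × Unique (a ∷ colors walk ++ [ b ])
    where open Bypass B

  Bypass⇒Rainbow : Bypass → Σ Bypass Rainbow
  Bypass⇒Rainbow record { hub = x ; a = a ; b = b ; a≢b = a≢b ; hub∈a = x∈a ; hub∈b = x∈b
                        ; start∈a = y∈a ; end∈b = y′∈b ; walk = w ; hub∉walk = x∉w }
    with shortcut b w y′∈b
  ... | record { walk = w′ ; end∈b = t∈b ; no-shortcut = ns ; ⊆vertices = w′⊆w } with lastInJob a w′
  ...   | inj₂ (y∉a ∷ _) = ⊥-elim (y∉a y∈a)
  ...   | inj₁ record { suffix = P ; is-suffix = sfx ; start∈a = q∈a ; leaves = leaves } =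
    record { hub = x ; a = a ; b = b ; a≢b = a≢b ; hub∈a = x∈a ; hub∈b = x∈b
           ; start∈a = q∈a ; end∈b = t∈b ; walk = P ; hub∉walk = x∉w ∘ w′⊆w ∘ Suffix-vertices sfx } ,
    NoShortcut⇒Unique P nsP , ∉-Unique a∉ (NoShortcut⇒Unique-colors P nsP)
    where
      nsP = Suffix-NoShortcut sfx ns
      a∉ : a ∉ colors P ++ [ b ]
      a∉ a∈ with ∈-++⁻ (colors P) a∈
      ... | inj₁ a∈P         = outside-job⇒∉colors P leaves a∈P
      ... | inj₂ (here refl) = a≢b refl

  Rainbow⇒RainbowCircuit : (B : Bypass) → Rainbow B → RainbowCircuit
  Rainbow⇒RainbowCircuit
    record { hub = x ; hub∈a = x∈a ; hub∈b = x∈b ; start∈a = q∈a ; end∈b = t∈b ; walk = P ; hub∉walk = x∉P } (uP , rb)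
    with jobEdge (x∉P ∘ here) x∈a q∈a
       | jobEdge (λ t≡x → x∉P (subst (_∈ vertices P) t≡x (end∈vertices P))) t∈b x∈b
  ... | g , refl , jg | h , refl , jh =
    record { closing = g ; closing-joins = jg ; path = P ++ᵂ cons h jh nil
           ; path-unique = subst Unique (sym (cong (_ ∷_) (vertices⁺-++ᵂ P _)))
                                 (Unique.++⁺ uP ([] ∷ []) λ { (x∈ , here refl) → x∉P x∈ })
           ; rainbow = subst Unique (sym (cong (_ ∷_) (colors-++ᵂ P _))) rb }

  Bypass⇒RainbowCircuit : Bypass → RainbowCircuit
  Bypass⇒RainbowCircuit B = let B′ , rainbow = Bypass⇒Rainbow B in Rainbow⇒RainbowCircuit B′ rainbow

  rainbowCycle⇒multicolorCycle : HasRainbowCycle S → HasMulticolorCycle S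
  rainbowCycle⇒multicolorCycle (C@record { 2≤len = s≤s (s≤s _) } , rainbow) =
    C , zero , suc zero , 0≢1+n ∘ rainbow zero (suc zero)

lemma8p2 : ∀ {n m : ℕ} (S : OpenShop n m) →
    (HasRainbowCycle S ⇔ HasMulticolorComponent S) × (HasMulticolorComponent S ⇔ HasMulticolorCycle S)
lemma8p2 S =
  mk⇔ (component ∘ multicolorCycle⇒Bypass S ∘ rainbowCycle⇒multicolorCycle S)
      (rainbowCycle ∘ multicolorComponent⇒Bypass S) ,
  mk⇔ (rainbowCycle⇒multicolorCycle S ∘ rainbowCycle ∘ multicolorComponent⇒Bypass S)
      (component ∘ multicolorCycle⇒Bypass S)
  where
    rainbowCycle : Bypass S → HasRainbowCycle S
    rainbowCycle = RainbowCircuit⇒rainbowCycle S ∘ Bypass⇒RainbowCircuit S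
    component : Bypass S → HasMulticolorComponent S
    component = RainbowCircuit⇒multicolorComponent S ∘ Bypass⇒RainbowCircuit S
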